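{- The calculus $\mathbf{ACT}^+_\omega$ is strongly complete w.r.t. PSCL-models with non-standard $\bot$: for any (possibly infinite) set of sequents $\mathcal{H}$ and any sequent $\Pi \to C$, if every PSCL-model with non-standard $\bot$ in which all sequents of $\mathcal{H}$ are true also makes $\Pi \to C$ true, then $\Pi \to C$ is derivable in $\mathbf{ACT}^+_\omega$ from $\mathcal{H}$.
   Context: Formulae are built from countably many variables and constants $\top,\bot$ using $\backslash$, $/$, $\cdot$, $\wedge$, $\vee$ and unary positive iteration ${}^+$. Sequents have the form $A_1,\dots,A_n \to B$ with $n\ge 1$ (Lambek's non-emptiness restriction; hypotheses also have non-empty antecedents). $\mathbf{MALC}^+$ is the multiplicative-additive Lambek calculus with axioms $A\to A$, $\Gamma,\bot,\Delta\to C$, $\Pi\to\top$, the usual left/right rules for $\cdot,\backslash,/,\wedge,\vee$ (with $\backslash$R, $/$R requiring non-empty $\Pi$), and Cut. $\mathbf{ACT}^+_\omega$ adds the $\omega$-rule: from $\Gamma,A^n,\Delta\to C$ for all $n\ge1$ infer $\Gamma,A^+,\Delta\to C$, and for $n\ge1$: from $\Pi_i\to A$ ($i=1..n$) infer $\Pi_1,\dots,\Pi_n\to A^+$. Derivability from hypotheses $\mathcal{H}$ treats them as extra axioms. PSCL-models: fix an alphabet $\Sigma$ and a language $L\subseteq\Sigma^+$. For $M\subseteq\Sigma^+$ let $M^{\rhd}=\{(x,y)\in\Sigma^*\times\Sigma^*\mid \forall w\in M\; xwy\in L\}$, and for a set of contexts $C$ let $C^{\lhd}=\{v\in\Sigma^+\mid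 \forall (x,y)\in C\; xvy\in L\}$. The set of closed languages $\{M\subseteq\Sigma^+\mid M=M^{\rhd\lhd}\}$ is ordered by $\subseteq$, with meet $\cap$, join $(M_1\cup M_2)^{\rhd\lhd}$, product $(M_1\cdot M_2)^{\rhd\lhd}$, divisions $M_1\backslash M_2=\{u\in\Sigma^+\mid\forall v\in M_1\; vu\in M_2\}$ and symmetric $/$, positive iteration $(M^+)^{\rhd\lhd}$, $\top=\Sigma^+$; this forms a $*$-continuous positive action lattice. A closed language $Z$ is a local zero if for every closed $M\supseteq Z$ we have $(M\cdot Z)^{\rhd\lhd}=(Z\cdot M)^{\rhd\lhd}=Z$; then the upper cone $\{M \text{ closed}\mid Z\subseteq M\}$ is closed under all operations, and taking $Z$ as the new $\bot$ gives a structure. A PSCL-model with non-standard $\bot$ is an interpretation of formulae in such an upper cone commuting with the operations and mapping $\top,\bot$ to $\Sigma^+, Z$; a sequent $A_1,\dots,A_n\to B$ is true if the (closed) product of the interpretations of the $A_i$ is contained in the interpretation of $B$. -}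

module Defs where

open import Data.Nat using (ℕ; zero; suc)
open import Data.List using (List; []; _∷_; _++_; replicate; concat)
open import Data.List.NonEmpty using (List⁺; _++⁺_; _⁺++_; _⁺++⁺_)
open import Data.Vec using (Vec; lookup; toList)
open import Data.Fin using (Fin)
open import Data.Product using (_×_; _,_; ∃; ∃-syntax)
open import Data.Sum using (_⊎_)
open import Data.Unit using (⊤)
open import Relation.Binary.PropositionalEquality using (_≡_; _≢_)

infixr 30 _·_
infixr 25 _∧_
infixr 24 _∨_
infixr 28 _⧵_
infixl 28 _/_
infix 35 _⁺

data Fm : Set where
  var  : ℕ → Fm
  ⊤ᶠ   : Fm
  ⊥ᶠ   : Fm
  _⧵_  : Fm → Fm → Fm
  _/_  : Fm → Fm → Fm
  _·_  : Fm → Fm → Fm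
  _∧_  : Fm → Fm → Fm
  _∨_  : Fm → Fm → Fm
  _⁺   : Fm → Fm

Hyps : Set₁
Hyps = List Fm → Fm → Set

infix 4 _⊢_⇒_

data _⊢_⇒_ (H : Hyps) : List Fm → Fm → Set where
  hyp  : ∀ {Π C} → H Π C → H ⊢ Π ⇒ C
  ax   : ∀ {A} → H ⊢ A ∷ [] ⇒ A
  ⊥L   : ∀ {Γ Δ C} → H ⊢ Γ ++ ⊥ᶠ ∷ Δ ⇒ C
  ⊤R   : ∀ {Π} → Π ≢ [] → H ⊢ Π ⇒ ⊤ᶠ
  ⧵L   : ∀ {Π Γ Δ A B C} → H ⊢ Π ⇒ A → H ⊢ Γ ++ B ∷ Δ ⇒ C
         → H ⊢ Γ ++ Π ++ (A ⧵ B) ∷ Δ ⇒ C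
  ⧵R   : ∀ {Π A B} → Π ≢ [] → H ⊢ A ∷ Π ⇒ B → H ⊢ Π ⇒ A ⧵ B
  /L   : ∀ {Π Γ Δ A B C} → H ⊢ Π ⇒ A → H ⊢ Γ ++ B ∷ Δ ⇒ C
         → H ⊢ Γ ++ (B / A) ∷ Π ++ Δ ⇒ C
  /R   : ∀ {Π A B} → Π ≢ [] → H ⊢ Π ++ A ∷ [] ⇒ B → H ⊢ Π ⇒ B / A
  ·L   : ∀ {Γ Δ A B C} → H ⊢ Γ ++ A ∷ B ∷ Δ ⇒ C → H ⊢ Γ ++ (A · B) ∷ Δ ⇒ C
  ·R   : ∀ {Γ Δ A B} → H ⊢ Γ ⇒ A → H ⊢ Δ ⇒ B → H ⊢ Γ ++ Δ ⇒ A · B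
  ∧L₁  : ∀ {Γ Δ A B C} → H ⊢ Γ ++ A ∷ Δ ⇒ C → H ⊢ Γ ++ (A ∧ B) ∷ Δ ⇒ C
  ∧L₂  : ∀ {Γ Δ A B C} → H ⊢ Γ ++ B ∷ Δ ⇒ C → H ⊢ Γ ++ (A ∧ B) ∷ Δ ⇒ C
  ∧R   : ∀ {Π A B} → H ⊢ Π ⇒ A → H ⊢ Π ⇒ B → H ⊢ Π ⇒ A ∧ B
  ∨L   : ∀ {Γ Δ A B C} → H ⊢ Γ ++ A ∷ Δ ⇒ C → H ⊢ Γ ++ B ∷ Δ ⇒ C
         → H ⊢ Γ ++ (A ∨ B) ∷ Δ ⇒ C
  ∨R₁  : ∀ {Π A B} → H ⊢ Π ⇒ A → H ⊢ Π ⇒ A ∨ B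
  ∨R₂  : ∀ {Π A B} → H ⊢ Π ⇒ B → H ⊢ Π ⇒ A ∨ B
  -- ω-rule: premises Γ, Aⁿ, Δ → C for all n ≥ 1 (n = suc k)
  ⁺Lω  : ∀ {Γ Δ A C} → (∀ k → H ⊢ Γ ++ replicate (suc k) A ++ Δ ⇒ C)
         → H ⊢ Γ ++ (A ⁺) ∷ Δ ⇒ C
  ⁺R   : ∀ {A} k (Πs : Vec (List Fm) (suc k)) → (∀ i → H ⊢ lookup Πs i ⇒ A)
         → H ⊢ concat (toList Πs) ⇒ A ⁺
  cut  : ∀ {Π Γ Δ A C} → H ⊢ Π ⇒ A → H ⊢ Γ ++ A ∷ Δ ⇒ C → H ⊢ Γ ++ Π ++ Δ ⇒ C

Lang : Set → Set₁
Lang S = List⁺ S → Set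

Ctx : Set → Set
Ctx S = List S × List S

plug : {S : Set} → Ctx S → List⁺ S → List⁺ S
plug (x , y) w = x ++⁺ (w ⁺++ y)

_⊆_ : {S : Set} → Lang S → Lang S → Set
M ⊆ N = ∀ w → M w → N w

_≐_ : {S : Set} → Lang S → Lang S → Set
M ≐ N = (M ⊆ N) × (N ⊆ M)

_⊗_ : {S : Set} → Lang S → Lang S → Lang S
(M ⊗ N) w = ∃[ u ] ∃[ v ] (M u × N v × w ≡ u ⁺++⁺ v)

data Plus {S : Set} (M : Lang S) : Lang S where
  one  : ∀ {w} → M w → Plus M w
  more : ∀ {u v} → M u → Plus M v → Plus M (u ⁺++⁺ v)

module Closure {S : Set} (L : Lang S) where

  rt : Lang S → Ctx S → Set
  rt M c = ∀ w → M w → L (plug c w)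

  lt : (Ctx S → Set) → Lang S
  lt C v = ∀ c → C c → L (plug c v)

  cl : Lang S → Lang S
  cl M = lt (rt M)

  Closed : Lang S → Set
  Closed M = M ≐ cl M

  _⊙_ : Lang S → Lang S → Lang S
  M ⊙ N = cl (M ⊗ N)

  _⊔_ : Lang S → Lang S → Lang S
  M ⊔ N = cl (λ w → M w ⊎ N w)

  _⊓_ : Lang S → Lang S → Lang S
  M ⊓ N = λ w → M w × N w

  _⟍_ : Lang S → Lang S → Lang S
  (M ⟍ N) u = ∀ v → M v → N (v ⁺++⁺ u)

  _⟋_ : Lang S → Lang S → Lang S
  (N ⟋ M) u = ∀ v → M v → N (u ⁺++⁺ v)

  plus : Lang S → Lang S
  plus M = cl (Plus M)

  full : Lang S
  full _ = ⊤

  IsLocalZero : Lang S → Set₁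
  IsLocalZero Z = Closed Z ×
    (∀ M → Closed M → Z ⊆ M → ((M ⊙ Z) ≐ Z) × ((Z ⊙ M) ≐ Z))

  module Interp (Z : Lang S) (val : ℕ → Lang S) where

    ⟦_⟧ : Fm → Lang S
    ⟦ var p ⟧ = val p
    ⟦ ⊤ᶠ ⟧    = full
    ⟦ ⊥ᶠ ⟧    = Z
    ⟦ A ⧵ B ⟧ = ⟦ A ⟧ ⟍ ⟦ B ⟧
    ⟦ B / A ⟧ = ⟦ B ⟧ ⟋ ⟦ A ⟧
    ⟦ A · B ⟧ = ⟦ A ⟧ ⊙ ⟦ B ⟧
    ⟦ A ∧ B ⟧ = ⟦ A ⟧ ⊓ ⟦ B ⟧
    ⟦ A ∨ B ⟧ = ⟦ A ⟧ ⊔ ⟦ B ⟧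
    ⟦ A ⁺ ⟧   = plus ⟦ A ⟧

    prod : Fm → List Fm → Lang S
    prod A []      = ⟦ A ⟧
    prod A (B ∷ Γ) = ⟦ A ⟧ ⊙ prod B Γ

    -- truth of a sequent Γ → B (empty antecedents never occur: vacuous)
    True : List Fm → Fm → Set
    True []      B = ⊤
    True (A ∷ Γ) B = prod A Γ ⊆ ⟦ B ⟧

record PSCLModel (S : Set) : Set₁ where
  field
    L       : Lang S
    Z       : Lang S
    zero-ok : Closure.IsLocalZero L Z
    val     : ℕ → Lang S
    val-ok  : ∀ p → Closure.Closed L (val p) × (Z ⊆ val p)

  TrueIn : List Fm → Fm → Set
  TrueIn = Closure.Interp.True L Z val

{-# OPTIONS --safe #-}
-- Take as letters the formulae (fm A) and goal markers (goal B), let L be the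
-- set of words Γ (goal B) with Γ → B derivable from H, and interpret A by
-- I A = {w | w → A derivable}.  Every I A is closed, since the context (ε, goal A) cuts out
-- exactly I A, and I ⊥ is a local zero since ⊥ absorbs everything.  By induction on A the
-- operations of the model agree with the connectives on the sets I A: the right rules put the
-- generators of each operation into I A, and the left rule (for ⁺ the ω-rule) shows that every
-- context accepting all generators accepts all of I A.  So the hypotheses hold in this model,
-- and evaluating Π → C at the word spelling Π gives derivability of Π → C.
module Submission where

open import Defs
open import Data.List using (List; []; _∷_; _++_; _∷ʳ_; [_]; map; replicate; concat; initLast; _∷ʳ′_)
open import Data.List.NonEmpty using (List⁺; _∷_; toList; _⁺++⁺_; _++⁺_; _⁺++_)
open import Data.List.Properties
  using (++-assoc; ++-identityʳ; map-++; map-∘; map-id; ∷ʳ-injective; ∷ʳ-injectiveʳ)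
import Data.Vec as Vec
open import Data.Vec.Properties using (lookup-replicate)
open import Data.Nat using (zero; suc)
open import Data.Fin using (Fin)
open import Data.Product using (_×_; _,_; ∃; ∃₂; proj₁; proj₂)
open import Data.Sum using (inj₁; inj₂)
open import Data.Unit using (tt)
open import Data.Empty using (⊥-elim)
open import Relation.Binary.PropositionalEquality
  using (_≡_; _≢_; refl; sym; trans; cong; subst; subst₂; module ≡-Reasoning)

variable
  H : Hyps
  Γ Δ Π Σ : List Fm
  A B C D E : Fm

cast : Γ ≡ Δ → H ⊢ Γ ⇒ A → H ⊢ Δ ⇒ A
cast {H = H} {A = A} = subst (λ Γ → H ⊢ Γ ⇒ A)

cutˡ : H ⊢ Π ⇒ A → H ⊢ A ∷ Δ ⇒ C → H ⊢ Π ++ Δ ⇒ C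
cutˡ = cut {Γ = []}

cutʳ : H ⊢ Π ⇒ A → H ⊢ Γ ∷ʳ A ⇒ C → H ⊢ Γ ++ Π ⇒ C
cutʳ {Π = Π} {Γ = Γ} d e = cast (cong (Γ ++_) (++-identityʳ Π)) (cut {Γ = Γ} {Δ = []} d e)

⊥-explode : H ⊢ Σ ⇒ ⊥ᶠ → H ⊢ Γ ++ Σ ++ Δ ⇒ C
⊥-explode {Γ = Γ} {Δ = Δ} d = cut {Γ = Γ} d (⊥L {Γ = Γ} {Δ = Δ})

from⊥ : H ⊢ Π ⇒ ⊥ᶠ → H ⊢ Π ⇒ C
from⊥ {Π = Π} d = cast (++-identityʳ Π) (⊥-explode {Γ = []} {Δ = []} d)

⧵-mp : H ⊢ Π ⇒ A → H ⊢ Σ ⇒ A ⧵ B → H ⊢ Π ++ Σ ⇒ B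
⧵-mp a f = cutʳ f (⧵L {Γ = []} {Δ = []} a ax)

/-mp : H ⊢ Σ ⇒ B / A → H ⊢ Π ⇒ A → H ⊢ Σ ++ Π ⇒ B
/-mp {Σ = Σ} {Π = Π} f a = cast (cong (Σ ++_) (++-identityʳ Π)) (cutˡ f (/L {Γ = []} {Δ = []} a ax))

∧-elimˡ : H ⊢ Π ⇒ A ∧ B → H ⊢ Π ⇒ A
∧-elimˡ {Π = Π} d = cast (++-identityʳ Π) (cutˡ d (∧L₁ {Γ = []} {Δ = []} ax))

∧-elimʳ : H ⊢ Π ⇒ A ∧ B → H ⊢ Π ⇒ B
∧-elimʳ {Π = Π} d = cast (++-identityʳ Π) (cutˡ d (∧L₂ {Γ = []} {Δ = []} ax))

⁺-intro : H ⊢ Π ⇒ A → H ⊢ Π ⇒ A ⁺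
⁺-intro {Π = Π} d = cast (++-identityʳ Π) (⁺R 0 (Π Vec.∷ Vec.[]) λ { Fin.zero → d })

concat-replicate-[-] : ∀ n (x : Fm) → concat (Vec.toList (Vec.replicate n [ x ])) ≡ replicate n x
concat-replicate-[-] zero    x = refl
concat-replicate-[-] (suc n) x = cong (x ∷_) (concat-replicate-[-] n x)

replicate⇒⁺ : ∀ n → H ⊢ replicate (suc n) A ⇒ A ⁺
replicate⇒⁺ {A = A} n = cast (concat-replicate-[-] (suc n) A)
  (⁺R n (Vec.replicate (suc n) [ A ]) λ i → cast (sym (lookup-replicate i [ A ])) ax)

⁺-step : H ⊢ A ∷ A ⁺ ∷ [] ⇒ A ⁺
⁺-step {A = A} = ⁺Lω {Γ = [ A ]} {Δ = []} λ n →
  cast (cong (A ∷_) (sym (++-identityʳ (replicate (suc n) A)))) (replicate⇒⁺ (suc n))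

⁺-cons : H ⊢ Π ⇒ A → H ⊢ Σ ⇒ A ⁺ → H ⊢ Π ++ Σ ⇒ A ⁺
⁺-cons a p = cutʳ p (cutˡ a ⁺-step)

∷ʳ-in-suffix : ∀ {X : Set} {a b : X} xs ys {us} →
               a ≢ b → xs ++ a ∷ ys ≡ us ∷ʳ b → ∃ λ zs → ys ≡ zs ∷ʳ b
∷ʳ-in-suffix {a = a} xs ys a≢b eq with initLast ys
... | []       = ⊥-elim (a≢b (∷ʳ-injectiveʳ xs _ eq))
... | zs ∷ʳ′ c =
  zs , cong (zs ∷ʳ_) (∷ʳ-injectiveʳ (xs ++ a ∷ zs) _ (trans (++-assoc xs (a ∷ zs) [ c ]) eq))

toList-++⁺ : ∀ {X : Set} (xs : List X) w → toList (xs ++⁺ w) ≡ xs ++ toList w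
toList-++⁺ []       w = refl
toList-++⁺ (x ∷ xs) w = cong (x ∷_) (toList-++⁺ xs w)

toList-plug : ∀ {X : Set} x y (w : List⁺ X) → toList (plug (x , y) w) ≡ x ++ toList w ++ y
toList-plug x y w = toList-++⁺ x (w ⁺++ y)

toList-plug-∷ʳ : ∀ {X : Set} x y w (g : X) → toList (plug (x , y ∷ʳ g) w) ≡ (x ++ toList w ++ y) ∷ʳ g
toList-plug-∷ʳ x y w g = begin
  toList (plug (x , y ∷ʳ g) w)  ≡⟨ toList-plug x (y ∷ʳ g) w ⟩
  x ++ toList w ++ y ∷ʳ g       ≡⟨ cong (x ++_) (++-assoc (toList w) y [ g ]) ⟨
  x ++ (toList w ++ y) ∷ʳ g     ≡⟨ ++-assoc x _ [ g ] ⟨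
  (x ++ toList w ++ y) ∷ʳ g     ∎
  where open ≡-Reasoning

toList-plug-last : ∀ {X : Set} x y {w : List⁺ X} {p a} →
                   toList w ≡ p ∷ʳ a → toList (plug (x , y) w) ≡ (x ++ p) ++ a ∷ y
toList-plug-last x y {w} {p} {a} w≡ = begin
  toList (plug (x , y) w)  ≡⟨ toList-plug x y w ⟩
  x ++ toList w ++ y       ≡⟨ cong (λ z → x ++ z ++ y) w≡ ⟩
  x ++ (p ∷ʳ a) ++ y       ≡⟨ cong (x ++_) (++-assoc p [ a ] y) ⟩
  x ++ p ++ a ∷ y          ≡⟨ ++-assoc x p (a ∷ y) ⟨
  (x ++ p) ++ a ∷ y        ∎
  where open ≡-Reasoning

≐-refl : ∀ {X : Set} {M : Lang X} → M ≐ M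
≐-refl = (λ _ m → m) , (λ _ m → m)

⊆-cl : ∀ {X : Set} (L M : Lang X) → M ⊆ Closure.cl L M
⊆-cl L M w m c r = r w m

module Canonical (H : Hyps) where

  data Letter : Set where
    fm goal : Fm → Letter

  -- a goal letter inside an antecedent is read as ⊥ᶠ, so words containing one lie in every I A
  tr : Letter → Fm
  tr (fm A)   = A
  tr (goal _) = ⊥ᶠ

  ⌞_⌟ : List Letter → List Fm
  ⌞_⌟ = map tr

  ⌜_⌝ : List Fm → List Letter
  ⌜_⌝ = map fm

  ⌞⌜⌝⌟ : ∀ Γ → ⌞ ⌜ Γ ⌝ ⌟ ≡ Γ
  ⌞⌜⌝⌟ Γ = trans (sym (map-∘ Γ)) (map-id Γ)

  ante : List⁺ Letter → List Fm
  ante w = ⌞ toList w ⌟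

  ante≢[] : ∀ w → ante w ≢ []
  ante≢[] _ ()

  ante-⁺++⁺ : ∀ u v → ante (u ⁺++⁺ v) ≡ ante u ++ ante v
  ante-⁺++⁺ u v = map-++ tr (toList u) (toList v)

  word : Fm → List Fm → List⁺ Letter
  word A Γ = fm A ∷ ⌜ Γ ⌝

  ante-word : ∀ A Γ → ante (word A Γ) ≡ A ∷ Γ
  ante-word A Γ = cong (A ∷_) (⌞⌜⌝⌟ Γ)

  L : Lang Letter
  L w = ∃₂ λ u B → toList w ≡ u ∷ʳ goal B × H ⊢ ⌞ u ⌟ ⇒ B

  ⌞⌟-++-++ : ∀ x v y → ⌞ x ++ v ++ y ⌟ ≡ ⌞ x ⌟ ++ ⌞ v ⌟ ++ ⌞ y ⌟
  ⌞⌟-++-++ x v y = trans (map-++ tr x (v ++ y)) (cong (⌞ x ⌟ ++_) (map-++ tr v y))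

  L-plug⁺ : ∀ x y w → H ⊢ ⌞ x ⌟ ++ ante w ++ ⌞ y ⌟ ⇒ E → L (plug (x , y ∷ʳ goal E) w)
  L-plug⁺ {E = E} x y w d =
    x ++ toList w ++ y , E , toList-plug-∷ʳ x y w (goal E) , cast (sym (⌞⌟-++-++ x (toList w) y)) d

  L-plug⁻ : ∀ x y w → L (plug (x , y ∷ʳ goal E) w) → H ⊢ ⌞ x ⌟ ++ ante w ++ ⌞ y ⌟ ⇒ E
  L-plug⁻ {E = E} x y w (u , B , eq , d)
    with refl , refl ← ∷ʳ-injective u _ (trans (sym eq) (toList-plug-∷ʳ x y w (goal E)))
    = cast (⌞⌟-++-++ x (toList w) y) d

  ctx : List Fm → List Fm → Fm → Ctx Letter
  ctx Ψ Δ E = ⌜ Ψ ⌝ , ⌜ Δ ⌝ ∷ʳ goal E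

  L-ctx⁺ : ∀ Ψ Δ E w → H ⊢ Ψ ++ ante w ++ Δ ⇒ E → L (plug (ctx Ψ Δ E) w)
  L-ctx⁺ Ψ Δ E w d =
    L-plug⁺ ⌜ Ψ ⌝ ⌜ Δ ⌝ w
      (subst₂ (λ X Y → H ⊢ X ++ ante w ++ Y ⇒ E) (sym (⌞⌜⌝⌟ Ψ)) (sym (⌞⌜⌝⌟ Δ)) d)

  L-ctx⁻ : ∀ Ψ Δ E w → L (plug (ctx Ψ Δ E) w) → H ⊢ Ψ ++ ante w ++ Δ ⇒ E
  L-ctx⁻ Ψ Δ E w p =
    subst₂ (λ X Y → H ⊢ X ++ ante w ++ Y ⇒ E) (⌞⌜⌝⌟ Ψ) (⌞⌜⌝⌟ Δ)
      (L-plug⁻ ⌜ Ψ ⌝ ⌜ Δ ⌝ w p)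

  open Closure L

  variable M N : Lang Letter

  I : Fm → Lang Letter
  I A w = H ⊢ ante w ⇒ A

  Replaces : List Fm → Lang Letter
  Replaces Γ w = ∀ Ψ Δ E → H ⊢ Ψ ++ Γ ++ Δ ⇒ E → H ⊢ Ψ ++ ante w ++ Δ ⇒ E

  Replaces-closed : N ⊆ Replaces Γ → cl N ⊆ Replaces Γ
  Replaces-closed N⊆ w w∈cl Ψ Δ E d =
    L-ctx⁻ Ψ Δ E w (w∈cl (ctx Ψ Δ E) λ v v∈N → L-ctx⁺ Ψ Δ E v (N⊆ v v∈N Ψ Δ E d))

  Replaces-⊗ : (Replaces Γ ⊗ Replaces Δ) ⊆ Replaces (Γ ++ Δ)
  Replaces-⊗ {Γ} {Δ} _ (u , v , ru , rv , refl) Ψ Φ E d = cast (cong (Ψ ++_) ante-uvΦ) uΓ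
    where
    vΔ : H ⊢ (Ψ ++ Γ) ++ ante v ++ Φ ⇒ E
    vΔ = rv (Ψ ++ Γ) Φ E (cast (trans (cong (Ψ ++_) (++-assoc Γ Δ Φ)) (sym (++-assoc Ψ Γ (Δ ++ Φ)))) d)

    uΓ : H ⊢ Ψ ++ ante u ++ ante v ++ Φ ⇒ E
    uΓ = ru Ψ (ante v ++ Φ) E (cast (++-assoc Ψ Γ (ante v ++ Φ)) vΔ)

    ante-uvΦ : ante u ++ ante v ++ Φ ≡ ante (u ⁺++⁺ v) ++ Φ
    ante-uvΦ = trans (sym (++-assoc (ante u) (ante v) Φ)) (cong (_++ Φ) (sym (ante-⁺++⁺ u v)))

  I⊆Replaces : I D ⊆ Replaces [ D ]
  I⊆Replaces w d Ψ Δ E e = cut {Γ = Ψ} d e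

  Replaces⊆I : H ⊢ Γ ⇒ D → Replaces Γ ⊆ I D
  Replaces⊆I {Γ} {D} d w r = cast (++-identityʳ (ante w)) (r [] [] D (cast (sym (++-identityʳ Γ)) d))

  cl⊆I : N ⊆ I D → cl N ⊆ I D
  cl⊆I N⊆I w w∈cl = Replaces⊆I ax w (Replaces-closed (λ v v∈N → I⊆Replaces v (N⊆I v v∈N)) w w∈cl)

  I-closed : ∀ D → Closed (I D)
  I-closed D = ⊆-cl L (I D) , cl⊆I (λ _ d → d)

  LeftRule : Lang Letter → Fm → Set
  LeftRule N D = ∀ Γ Δ E → (∀ w → N w → H ⊢ Γ ++ ante w ++ Δ ⇒ E) → H ⊢ Γ ++ D ∷ Δ ⇒ E

  -- a generator ending in a formula letter forces every context accepting N to end in a goal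
  I⊆cl : ∀ w₀ p F → N w₀ → toList w₀ ≡ p ∷ʳ fm F → LeftRule N D → I D ⊆ cl N
  I⊆cl w₀ p F w₀∈N w₀≡ rule w d (x , y) r
    with _ , B , eq , _ ← r w₀ w₀∈N
    with y' , refl ← ∷ʳ-in-suffix (x ++ p) y (λ ()) (trans (sym (toList-plug-last x y w₀≡)) eq)
    = L-plug⁺ x y' w (cut {Γ = ⌞ x ⌟} d (rule ⌞ x ⌟ ⌞ y' ⌟ B λ v v∈N → L-plug⁻ x y' v (r v v∈N)))

  ⊥-rule : LeftRule N ⊥ᶠ
  ⊥-rule Γ _ _ _ = ⊥L {Γ = Γ}

  fm∈ : I A ⊆ M → M (fm A ∷ [])
  fm∈ ⊆M = ⊆M _ ax

  I-⧵ : M ≐ I A → N ≐ I B → (M ⟍ N) ≐ I (A ⧵ B)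
  I-⧵ {A = A} (M⊆ , ⊆M) (N⊆ , ⊆N) =
    (λ u f → ⧵R (ante≢[] u) (N⊆ _ (f (fm A ∷ []) (fm∈ ⊆M)))) ,
    (λ u d v a → ⊆N _ (cast (sym (ante-⁺++⁺ v u)) (⧵-mp (M⊆ v a) d)))

  I-/ : M ≐ I A → N ≐ I B → (N ⟋ M) ≐ I (B / A)
  I-/ {A = A} (M⊆ , ⊆M) (N⊆ , ⊆N) =
    (λ u f → /R (ante≢[] u) (cast (ante-⁺++⁺ u (fm A ∷ [])) (N⊆ _ (f (fm A ∷ []) (fm∈ ⊆M))))) ,
    (λ u d v a → ⊆N _ (cast (sym (ante-⁺++⁺ u v)) (/-mp d (M⊆ v a))))

  I-· : M ≐ I A → N ≐ I B → (M ⊙ N) ≐ I (A · B)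
  I-· {M = M} {A = A} {N = N} {B = B} (M⊆ , ⊆M) (N⊆ , ⊆N) =
    cl⊆I (λ { _ (u , v , a , b , refl) → cast (sym (ante-⁺++⁺ u v)) (·R (M⊆ u a) (N⊆ v b)) }) ,
    I⊆cl _ [ fm A ] B AB refl (λ Γ Δ E k → ·L {Γ = Γ} (k _ AB))
    where
    AB : (M ⊗ N) (fm A ∷ fm B ∷ [])
    AB = fm A ∷ [] , fm B ∷ [] , fm∈ ⊆M , fm∈ ⊆N , refl

  I-∧ : M ≐ I A → N ≐ I B → (M ⊓ N) ≐ I (A ∧ B)
  I-∧ (M⊆ , ⊆M) (N⊆ , ⊆N) =
    (λ w (a , b) → ∧R (M⊆ w a) (N⊆ w b)) ,
    (λ w d → ⊆M w (∧-elimˡ d) , ⊆N w (∧-elimʳ d))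

  I-∨ : M ≐ I A → N ≐ I B → (M ⊔ N) ≐ I (A ∨ B)
  I-∨ {A = A} (M⊆ , ⊆M) (N⊆ , ⊆N) =
    cl⊆I (λ { w (inj₁ a) → ∨R₁ (M⊆ w a) ; w (inj₂ b) → ∨R₂ (N⊆ w b) }) ,
    I⊆cl _ [] A (inj₁ (fm∈ ⊆M)) refl
      (λ Γ Δ E k → ∨L {Γ = Γ} (k _ (inj₁ (fm∈ ⊆M))) (k _ (inj₂ (fm∈ ⊆N))))

  I-⁺ : M ≐ I A → plus M ≐ I (A ⁺)
  I-⁺ {M = M} {A = A} (M⊆ , ⊆M) = cl⊆I Plus⊆I , I⊆cl _ [] A (one (fm∈ ⊆M)) refl ⁺-rule
    where
    Plus⊆I : Plus M ⊆ I (A ⁺)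
    Plus⊆I w (one a)             = ⁺-intro (M⊆ w a)
    Plus⊆I _ (more {u} {v} a as) = cast (sym (ante-⁺++⁺ u v)) (⁺-cons (M⊆ u a) (Plus⊆I v as))

    power∈Plus : ∀ n → Plus M (word A (replicate n A))
    power∈Plus zero    = one (fm∈ ⊆M)
    power∈Plus (suc n) = more (fm∈ ⊆M) (power∈Plus n)

    ⁺-rule : LeftRule (Plus M) (A ⁺)
    ⁺-rule Γ Δ E k = ⁺Lω {Γ = Γ} λ n →
      cast (cong (λ X → Γ ++ X ++ Δ) (ante-word A (replicate n A))) (k _ (power∈Plus n))

  ⊙-I⊥ : I ⊥ᶠ ⊆ M → (M ⊙ I ⊥ᶠ) ≐ I ⊥ᶠ
  ⊙-I⊥ Z⊆M =
    cl⊆I (λ { _ (u , v , _ , z , refl) → cast (ante-uv u v) (⊥-explode {Γ = ante u} {Δ = []} z) }) ,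
    I⊆cl _ [ fm ⊥ᶠ ] ⊥ᶠ (fm ⊥ᶠ ∷ [] , fm ⊥ᶠ ∷ [] , fm∈ Z⊆M , ax , refl) refl ⊥-rule
    where
    ante-uv : ∀ u v → ante u ++ ante v ++ [] ≡ ante (u ⁺++⁺ v)
    ante-uv u v = trans (cong (ante u ++_) (++-identityʳ (ante v))) (sym (ante-⁺++⁺ u v))

  I⊥-⊙ : I ⊥ᶠ ⊆ M → (I ⊥ᶠ ⊙ M) ≐ I ⊥ᶠ
  I⊥-⊙ Z⊆M =
    cl⊆I (λ { _ (u , v , z , _ , refl) →
      cast (sym (ante-⁺++⁺ u v)) (⊥-explode {Γ = []} {Δ = ante v} z) }) ,
    I⊆cl _ [ fm ⊥ᶠ ] ⊥ᶠ (fm ⊥ᶠ ∷ [] , fm ⊥ᶠ ∷ [] , ax , fm∈ Z⊆M , refl) refl ⊥-rule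

  I⊥-localZero : IsLocalZero (I ⊥ᶠ)
  I⊥-localZero = I-closed ⊥ᶠ , λ M _ Z⊆M → ⊙-I⊥ Z⊆M , I⊥-⊙ Z⊆M

  open Interp (I ⊥ᶠ) (λ p → I (var p))

  ⟦⟧≐I : ∀ A → ⟦ A ⟧ ≐ I A
  ⟦⟧≐I (var p) = ≐-refl
  ⟦⟧≐I ⊤ᶠ      = (λ w _ → ⊤R (ante≢[] w)) , (λ _ _ → tt)
  ⟦⟧≐I ⊥ᶠ      = ≐-refl
  ⟦⟧≐I (A ⧵ B) = I-⧵ (⟦⟧≐I A) (⟦⟧≐I B)
  ⟦⟧≐I (B / A) = I-/ (⟦⟧≐I A) (⟦⟧≐I B)
  ⟦⟧≐I (A · B) = I-· (⟦⟧≐I A) (⟦⟧≐I B)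
  ⟦⟧≐I (A ∧ B) = I-∧ (⟦⟧≐I A) (⟦⟧≐I B)
  ⟦⟧≐I (A ∨ B) = I-∨ (⟦⟧≐I A) (⟦⟧≐I B)
  ⟦⟧≐I (A ⁺)   = I-⁺ (⟦⟧≐I A)

  model : PSCLModel Letter
  model = record
    { L = L ; Z = I ⊥ᶠ ; zero-ok = I⊥-localZero
    ; val = λ p → I (var p) ; val-ok = λ p → I-closed (var p) , λ _ → from⊥ }

  prod⊆Replaces : ∀ A Γ → prod A Γ ⊆ Replaces (A ∷ Γ)
  prod⊆Replaces A []      w a = I⊆Replaces w (proj₁ (⟦⟧≐I A) w a)
  prod⊆Replaces A (B ∷ Γ) = Replaces-closed λ { w (u , v , a , p , w≡uv) →
    Replaces-⊗ {Γ = [ A ]} w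
      (u , v , I⊆Replaces u (proj₁ (⟦⟧≐I A) u a) , prod⊆Replaces B Γ v p , w≡uv) }

  word∈prod : ∀ A Γ → prod A Γ (word A Γ)
  word∈prod A []      = fm∈ (proj₂ (⟦⟧≐I A))
  word∈prod A (B ∷ Γ) =
    ⊆-cl L _ _ (fm A ∷ [] , word B Γ , fm∈ (proj₂ (⟦⟧≐I A)) , word∈prod B Γ , refl)

  derivable⇒true : H ⊢ Γ ⇒ C → PSCLModel.TrueIn model Γ C
  derivable⇒true {[]}    _ = tt
  derivable⇒true {A ∷ Γ} {C} d w p = proj₂ (⟦⟧≐I C) w (Replaces⊆I d w (prod⊆Replaces A Γ w p))

  true⇒derivable : PSCLModel.TrueIn model (A ∷ Γ) C → H ⊢ A ∷ Γ ⇒ C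
  true⇒derivable {A} {Γ} {C} t = cast (ante-word A Γ) (proj₁ (⟦⟧≐I C) _ (t _ (word∈prod A Γ)))

theorem1 : (H : Hyps) → (∀ Γ D → H Γ D → Γ ≢ []) →
    (Π : List Fm) (C : Fm) → Π ≢ [] →
    (∀ (S : Set) (𝓜 : PSCLModel S) →
       (∀ Γ D → H Γ D → PSCLModel.TrueIn 𝓜 Γ D) → PSCLModel.TrueIn 𝓜 Π C) →
    H ⊢ Π ⇒ C
theorem1 H _ []      C Π≢[] _     = ⊥-elim (Π≢[] refl)
theorem1 H _ (A ∷ Γ) C _    valid =
  true⇒derivable (valid Letter model λ Γ D h → derivable⇒true (hyp h))
  where open Canonical H
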